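{- Let $\lambda$ be a partition whose Young diagram is a rectangle, let $S\in\{S_1,\dots,S_8\}$, and let $\gamma:\mathcal{T}(\lambda)\to\mathcal{T}(\lambda)$ be a bijection such that for every $\sigma$: $\gamma(\sigma)$ is row-equivalent to $\sigma$, $\mathrm{maj}(\gamma(\sigma))=\mathrm{maj}(\sigma)$, $\eta_S(\gamma(\sigma))=\mathrm{quinv}(\sigma)$, the top rows of $\gamma(\sigma)$ and $\sigma$ coincide, and for every $r$ the number of columns $c$ with $\gamma(\sigma)(r+1,c)>\gamma(\sigma)(r,c)$ equals the number of columns $c$ with $\sigma(r+1,c)>\sigma(r,c)$. For $\sigma\in\mathcal{T}(\lambda)$ with largest entry $N$, let $\sigma'$ (resp. $\gamma(\sigma)'$) be obtained from $\sigma$ (resp. $\gamma(\sigma)$) by replacing every entry $x$ by $N+1-x$ and turning the filling upside down. Then $\gamma(\sigma)'$ is row-equivalent to $\sigma'$, the bottom rows of $\gamma(\sigma)'$ and $\sigma'$ are identical, and $$\mathrm{maj}(\gamma(\sigma)')=\mathrm{maj}(\sigma'),\qquad \eta^{*(S)}(\gamma(\sigma)')=\mathrm{inv}(\sigma').$$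
   Context: French Young diagram of $\lambda$ with cells $(r,c)$ (row $r$ from the bottom, column $c$ from the left), $\lambda'_c$ = height of column $c$. $\mathcal{T}(\lambda)$ = fillings by positive integers; conventions $\sigma(\lambda'_c+1,c)=0$, $\sigma(0,c)=\infty$ (larger than all integers). Row-equivalent: same multiset of entries in each row. A cell $(r,c)$, $2\le r\le\lambda'_c$, is a descent if $\sigma(r,c)>\sigma(r-1,c)$; $\mathrm{maj}(\sigma)=\sum_{\text{descents}}(\lambda'_c-r+1)$. $Q(a,b,c)=1$ iff $a<b<c$ or $b<c<a$ or $c<a<b$ or $a=b\ne c$, else $0$. $\mathrm{quinv}(\sigma)$ = number of triples $((r+1,c),(r,c),(r,d))$ with $c<d$, $1\le r\le\lambda'_d$, $Q(\sigma(r+1,c),\sigma(r,c),\sigma(r,d))=1$. $\mathrm{inv}(\sigma)$ = number of triples $((r,c),(r-1,c),(r,d))$ with $c<d$, $1\le r\le\lambda'_d$, $Q(\sigma(r,c),\sigma(r-1,c),\sigma(r,d))=1$. Pattern sets: $S^*$ = chains $z=w>v>u$, $u\ge z=w>v$, $v>u\ge z=w$; each $S_i$ consists of $S^*$, the chains $z>v\ge w>u$, $u\ge z>v\ge w$ and: $S_1$: $z>w>v>u$, $u>v\ge z>w$, $z>u>v\ge w$, $v\ge z>w>u$; $S_2$: $z>w>v>u$, $v>u\ge z>w$, $z>u>v\ge w$, $v\ge z>w>u$; $S_3$: $z>w>u>v$, $u>v\ge z>w$, $z>u>v\ge w$, $v\ge z>w>u$; $S_4$: $z>w>u>v$, $v>u\ge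 z>w$, $z>u>v\ge w$, $v\ge z>w>u$; $S_5$: $z>w>v>u$, $u>v\ge z>w$, $z>v>u\ge w$, $u\ge z>w>v$; $S_6$: $z>w>u>v$, $u>v\ge z>w$, $z>v>u\ge w$, $u\ge z>w>v$; $S_7$: $z>w>v>u$, $v>u\ge z>w$, $z>v>u\ge w$, $u\ge z>w>v$; $S_8$: $z>w>u>v$, $v>u\ge z>w$, $z>v>u\ge w$, $u\ge z>w>v$. $Q_S(z,w,u,v)=1$ iff $(z,w,u,v)$ satisfies a chain of $S^*$, or one of the six further chains of $S$, or $(w,z,v,u)$ satisfies one of those six chains. $\eta_S(\sigma)$ = number of 4-tuples of cells $(r+1,c),(r+1,d),(r,c),(r,d)$ with $c<d$, $\lambda'_c=\lambda'_d$, $1\le r\le\lambda'_c$, $Q_S(\sigma(r+1,c),\sigma(r+1,d),\sigma(r,c),\sigma(r,d))=1$. For $\tau\in\mathcal{T}(\lambda)$ with largest entry $M$, $\tau^\natural$ is obtained by replacing each entry $x$ by $M+1-x$ and turning each maximal rectangle of equal-height columns upside down; $\eta^{*(S)}(\tau)=\eta_S(\tau^\natural)+$ the number of triples counted by $\mathrm{inv}(\tau)$ with $\lambda'_d<\lambda'_c$ (for a rectangle this second term is $0$). -}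

module Defs where

open import Data.Bool using (Bool; true; false; _∧_; _∨_; not; if_then_else_)
open import Data.Nat using (ℕ; zero; suc; _+_; _*_; _∸_; _⊔_; _<ᵇ_; _≡ᵇ_; _<_; _≤_; _<?_)
open import Data.Fin using (Fin; toℕ; fromℕ<; opposite)
open import Data.List using (List; []; _∷_; map; upTo; allFin; concatMap)
open import Data.Nat.ListAction using (sum)
open import Data.List.Relation.Binary.Permutation.Propositional using (_↭_)
open import Data.Product using (Σ; _×_; ∃)
open import Relation.Binary.PropositionalEquality using (_≡_)
open import Relation.Nullary using (yes; no)

-- Fillings of the rectangular shape with k rows and n columns
-- (French convention).  σ i c is the entry of cell (r , c) with
-- r = toℕ i + 1 (row counted from the bottom, starting at 1) and
-- column c (counted from the left).

Filling : ℕ → ℕ → Set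
Filling k n = Fin k → Fin n → ℕ

-- 𝒯(λ): fillings by positive integers
Positive : ∀ {k n} → Filling k n → Set
Positive σ = ∀ i c → 0 < σ i c

_≗F_ : ∀ {k n} → Filling k n → Filling k n → Set
σ ≗F τ = ∀ i c → σ i c ≡ τ i c

IsBijectionOnT : ∀ {k n} → (Filling k n → Filling k n) → Set
IsBijectionOnT {k} {n} γ =
  (∀ σ → Positive σ → Positive (γ σ))
  × (∀ σ τ → Positive σ → Positive τ → γ σ ≗F γ τ → σ ≗F τ)
  × (∀ τ → Positive τ → Σ (Filling k n) λ σ → Positive σ × (γ σ ≗F τ))

data Ext : Set where
  fin : ℕ → Ext
  ∞   : Ext

_<ₑ_ : Ext → Ext → Bool
fin a <ₑ fin b = a <ᵇ b
fin a <ₑ ∞     = true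
∞     <ₑ _     = false

_=ₑ_ : Ext → Ext → Bool
fin a =ₑ fin b = a ≡ᵇ b
fin a =ₑ ∞     = false
∞     =ₑ fin b = false
∞     =ₑ ∞     = true

_≤ₑ_ : Ext → Ext → Bool
a ≤ₑ b = (a <ₑ b) ∨ (a =ₑ b)

-- σ(r , c) for r : ℕ with conventions σ(0,c) = ∞, σ(k+1,c) = 0
-- (and 0 above that, never used)
ext : ∀ {k n} → Filling k n → ℕ → Fin n → Ext
ext σ zero c = ∞
ext {k} σ (suc r) c with r <? k
... | yes p = fin (σ (fromℕ< p) c)
... | no _  = fin 0

bit : Bool → ℕ
bit true  = 1
bit false = 0

rows : ℕ → List ℕ
rows k = map suc (upTo k)

sumPairs : ∀ n → (Fin n → Fin n → ℕ) → ℕ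
sumPairs n f = sum (concatMap (λ c → map (λ d → if toℕ c <ᵇ toℕ d then f c d else 0) (allFin n)) (allFin n))

sumCols : ∀ n → (Fin n → ℕ) → ℕ
sumCols n f = sum (map f (allFin n))

Q : Ext → Ext → Ext → Bool
Q a b c = ((a <ₑ b) ∧ (b <ₑ c)) ∨ ((b <ₑ c) ∧ (c <ₑ a)) ∨ ((c <ₑ a) ∧ (a <ₑ b))
          ∨ ((a =ₑ b) ∧ not (b =ₑ c))

maj : ∀ {k n} → Filling k n → ℕ
maj {k} {n} σ = sumCols n λ c → sum (map (λ r →
  bit ((2 Data.Nat.≤ᵇ r) ∧ (ext σ (r ∸ 1) c <ₑ ext σ r c)) * (k ∸ r + 1)) (rows k))
  where open import Data.Nat using (_≤ᵇ_)

quinv : ∀ {k n} → Filling k n → ℕ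
quinv {k} {n} σ = sum (map (λ r → sumPairs n λ c d →
  bit (Q (ext σ (suc r) c) (ext σ r c) (ext σ r d))) (rows k))

inv : ∀ {k n} → Filling k n → ℕ
inv {k} {n} σ = sum (map (λ r → sumPairs n λ c d →
  bit (Q (ext σ r c) (ext σ (r ∸ 1) c) (ext σ r d))) (rows k))

-- number of inv-triples with λ'_d < λ'_c (column heights are all k here)
invTallLeft : ∀ {k n} → Filling k n → ℕ
invTallLeft {k} {n} σ = sum (map (λ r → sumPairs n λ c d →
  bit ((k <ᵇ k) ∧ Q (ext σ r c) (ext σ (r ∸ 1) c) (ext σ r d))) (rows k))

data PatternSet : Set where
  S₁ S₂ S₃ S₄ S₅ S₆ S₇ S₈ : PatternSet

Chain : Set
Chain = Ext → Ext → Ext → Ext → Bool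

sStar : Chain
sStar z w u v = ((z =ₑ w) ∧ (v <ₑ w) ∧ (u <ₑ v))
              ∨ ((z ≤ₑ u) ∧ (z =ₑ w) ∧ (v <ₑ w))
              ∨ ((u <ₑ v) ∧ (z ≤ₑ u) ∧ (z =ₑ w))

common₁ common₂ : Chain
common₁ z w u v = (v <ₑ z) ∧ (w ≤ₑ v) ∧ (u <ₑ w)
common₂ z w u v = (z ≤ₑ u) ∧ (v <ₑ z) ∧ (w ≤ₑ v)

A1 A2 B1 B2 C1 C2 D1 D2 : Chain
A1 z w u v = (w <ₑ z) ∧ (v <ₑ w) ∧ (u <ₑ v)
A2 z w u v = (w <ₑ z) ∧ (u <ₑ w) ∧ (v <ₑ u)
B1 z w u v = (v <ₑ u) ∧ (z ≤ₑ v) ∧ (w <ₑ z)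
B2 z w u v = (u <ₑ v) ∧ (z ≤ₑ u) ∧ (w <ₑ z)
C1 z w u v = (u <ₑ z) ∧ (v <ₑ u) ∧ (w ≤ₑ v)
C2 z w u v = (v <ₑ z) ∧ (u <ₑ v) ∧ (w ≤ₑ u)
D1 z w u v = (z ≤ₑ v) ∧ (w <ₑ z) ∧ (u <ₑ w)
D2 z w u v = (z ≤ₑ u) ∧ (w <ₑ z) ∧ (v <ₑ w)

specific : PatternSet → Chain
specific S₁ z w u v = A1 z w u v ∨ B1 z w u v ∨ C1 z w u v ∨ D1 z w u v
specific S₂ z w u v = A1 z w u v ∨ B2 z w u v ∨ C1 z w u v ∨ D1 z w u v
specific S₃ z w u v = A2 z w u v ∨ B1 z w u v ∨ C1 z w u v ∨ D1 z w u v
specific S₄ z w u v = A2 z w u v ∨ B2 z w u v ∨ C1 z w u v ∨ D1 z w u v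
specific S₅ z w u v = A1 z w u v ∨ B1 z w u v ∨ C2 z w u v ∨ D2 z w u v
specific S₆ z w u v = A2 z w u v ∨ B1 z w u v ∨ C2 z w u v ∨ D2 z w u v
specific S₇ z w u v = A1 z w u v ∨ B2 z w u v ∨ C2 z w u v ∨ D2 z w u v
specific S₈ z w u v = A2 z w u v ∨ B2 z w u v ∨ C2 z w u v ∨ D2 z w u v

six : PatternSet → Chain
six S z w u v = common₁ z w u v ∨ common₂ z w u v ∨ specific S z w u v

Q-S : PatternSet → Chain
Q-S S z w u v = sStar z w u v ∨ six S z w u v ∨ six S w z v u

-- η_S: 4-tuples (r+1,c),(r+1,d),(r,c),(r,d), c < d, λ'_c = λ'_d, 1 ≤ r ≤ λ'_c
-- (in a rectangle all columns have the same height k)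
η : ∀ {k n} → PatternSet → Filling k n → ℕ
η {k} {n} S σ = sum (map (λ r → sumPairs n λ c d →
  bit (Q-S S (ext σ (suc r) c) (ext σ (suc r) d) (ext σ r c) (ext σ r d))) (rows k))

maxEntry : ∀ {k n} → Filling k n → ℕ
maxEntry {k} {n} σ = Data.List.foldr _⊔_ 0
  (concatMap (λ i → map (σ i) (allFin n)) (allFin k))

complFlip : ∀ {k n} → ℕ → Filling k n → Filling k n
complFlip N σ i c = suc N ∸ σ (opposite i) c

-- τ♮ (a rectangle is a single maximal rectangle of equal-height columns)
natural : ∀ {k n} → Filling k n → Filling k n
natural τ = complFlip (maxEntry τ) τ

η* : ∀ {k n} → PatternSet → Filling k n → ℕ
η* S τ = η S (natural τ) + invTallLeft τ

RowEquivalent : ∀ {k n} → Filling k n → Filling k n → Set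
RowEquivalent {k} {n} σ τ = ∀ i → map (σ i) (allFin n) ↭ map (τ i) (allFin n)

SameTopRow : ∀ {k n} → Filling k n → Filling k n → Set
SameTopRow {k} σ τ = ∀ i c → toℕ i ≡ k ∸ 1 → σ i c ≡ τ i c

SameBottomRow : ∀ {k n} → Filling k n → Filling k n → Set
SameBottomRow σ τ = ∀ i c → toℕ i ≡ 0 → σ i c ≡ τ i c

ascents : ∀ {k n} → Filling k n → ℕ → ℕ
ascents {k} {n} σ r = sumCols n λ c → bit (ext σ r c <ₑ ext σ (suc r) c)

-- On the extended values read by ext, complFlip N acts as the order-reversing map
-- x ↦ N + 1 − x (exchanging the sentinels 0 and ∞) composed with turning the rows upside
-- down.  Hence a descent of the flip in row r is an ascent of the original from row
-- k + 1 − r; the bottom row carries no descents, so maj of a flip only sees the ascent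
-- counts of rows 1 … k − 1, which γ preserves.  The Q-triples of inv on a flip are
-- exactly the reversed quinv triples of the original, so inv σ′ = quinv σ.  Finally
-- τ′♮ = (τ′)′ undoes the flip up to an order-preserving relabelling of the entries, and
-- η_S only depends on relative order, so η*(γ(σ)′) = η_S(γσ) = quinv σ = inv σ′.
module Submission where

open import Defs
open import Data.Bool using (true; false; T; _∧_; _∨_; not; if_then_else_)
open import Data.Bool.Properties using (T-≡)
open import Data.Empty using (⊥-elim)
open import Data.Fin using (Fin; toℕ; fromℕ<; opposite)
open import Data.Fin.Properties using (fromℕ<-toℕ; toℕ-fromℕ<; toℕ<n; opposite-prop)
open import Data.List using ([]; _∷_; map; foldr; upTo; allFin; applyUpTo; applyDownFrom; reverse)
open import Data.List.Properties using (map-cong; map-cong-local; map-∘; map-applyUpTo; reverse-applyUpTo; concatMap-cong)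
open import Data.List.Relation.Unary.All using (All; []; _∷_; universal)
open import Data.List.Relation.Unary.All.Properties using (applyUpTo⁺₁; concat⁺)
  renaming (map⁺ to All-map⁺)
open import Data.List.Relation.Unary.Any as Any using (here; there)
open import Data.List.Membership.Propositional using (_∈_)
open import Data.List.Membership.Propositional.Properties using (∈-allFin; ∈-map⁺; ∈-map⁻; ∈-concatMap⁺)
open import Data.List.Relation.Binary.Permutation.Propositional using (_↭_)
open import Data.List.Relation.Binary.Permutation.Propositional.Properties
  using (↭-reverse; ∈-resp-↭) renaming (map⁺ to ↭-map⁺)
open import Data.Nat using (ℕ; zero; suc; _+_; _*_; _∸_; _⊔_; _<_; _≤_; _<ᵇ_; _≡ᵇ_; _≤ᵇ_; _<?_; z≤n; s≤s)
open import Data.Nat.ListAction using (sum)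
open import Data.Nat.ListAction.Properties using (sum-↭)
open import Data.Nat.Properties
open import Algebra.Properties.CommutativeSemigroup Data.Nat.Properties.+-commutativeSemigroup
  using (interchange)
open import Data.Product using (_,_; _×_)
open import Data.Unit using (⊤; tt)
open import Function using (_∘_; id)
open import Function.Bundles using (Equivalence)
open import Relation.Binary.PropositionalEquality
open import Relation.Nullary using (yes; no)
open import Relation.Nullary.Reflects using (Reflects; det; fromEquivalence)

≡true : ∀ {b} → T b → b ≡ true
≡true = Equivalence.to T-≡

≡ᵇ-reflects : ∀ m n → Reflects (m ≡ n) (m ≡ᵇ n)
≡ᵇ-reflects m n = fromEquivalence (≡ᵇ⇒≡ m n) (≡⇒≡ᵇ m n)

∸-<ᵇ-reverse : ∀ {N x} y → x ≤ N → (N ∸ x <ᵇ N ∸ y) ≡ (y <ᵇ x)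
∸-<ᵇ-reverse {N} {x} y x≤N = det (<ᵇ-reflects-< (N ∸ x) (N ∸ y)) (fromEquivalence
  (λ y<ᵇx → ∸-monoʳ-< (<ᵇ⇒< y x y<ᵇx) x≤N)
  (λ N∸x<N∸y → <⇒<ᵇ {y} {x} (≰⇒> (λ x≤y → <⇒≱ N∸x<N∸y (∸-monoʳ-≤ N x≤y)))))

∸-≡ᵇ-reverse : ∀ {N x y} → x ≤ N → y ≤ N → (N ∸ x ≡ᵇ N ∸ y) ≡ (x ≡ᵇ y)
∸-≡ᵇ-reverse {N} {x} {y} x≤N y≤N = det (≡ᵇ-reflects (N ∸ x) (N ∸ y)) (fromEquivalence
  (λ x≡ᵇy → cong (N ∸_) (≡ᵇ⇒≡ x y x≡ᵇy))
  (λ N∸x≡N∸y → ≡⇒≡ᵇ x y (∸-cancelˡ-≡ x≤N y≤N N∸x≡N∸y)))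

InRange : ℕ → Ext → Set
InRange N (fin x) = x ≤ N
InRange N ∞       = ⊤

reflect : ℕ → Ext → Ext
reflect N ∞             = fin 0
reflect N (fin zero)    = ∞
reflect N (fin (suc x)) = fin (N ∸ x)

reflect-fin : ∀ N {x} → 0 < x → reflect N (fin x) ≡ fin (suc N ∸ x)
reflect-fin N {suc x} _ = refl

reflect-<ₑ : ∀ N a b → InRange N a → InRange N b → (reflect N a <ₑ reflect N b) ≡ (b <ₑ a)
reflect-<ₑ N ∞             ∞             _   _   = refl
reflect-<ₑ N ∞             (fin zero)    _   _   = refl
reflect-<ₑ N ∞             (fin (suc y)) _   y<N = ≡true (<⇒<ᵇ (m<n⇒0<n∸m y<N))
reflect-<ₑ N (fin zero)    ∞             _   _   = refl
reflect-<ₑ N (fin zero)    (fin zero)    _   _   = refl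
reflect-<ₑ N (fin zero)    (fin (suc y)) _   _   = refl
reflect-<ₑ N (fin (suc x)) ∞             _   _   = refl
reflect-<ₑ N (fin (suc x)) (fin zero)    _   _   = refl
reflect-<ₑ N (fin (suc x)) (fin (suc y)) x<N _   = ∸-<ᵇ-reverse y (<⇒≤ x<N)

reflect-=ₑ : ∀ N a b → InRange N a → InRange N b → (reflect N a =ₑ reflect N b) ≡ (a =ₑ b)
reflect-=ₑ N ∞             ∞             _   _   = refl
reflect-=ₑ N ∞             (fin zero)    _   _   = refl
reflect-=ₑ N ∞             (fin (suc y)) _   y<N with N ∸ y | m<n⇒0<n∸m y<N
... | suc _ | _ = refl
reflect-=ₑ N (fin zero)    ∞             _   _   = refl
reflect-=ₑ N (fin zero)    (fin zero)    _   _   = refl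
reflect-=ₑ N (fin zero)    (fin (suc y)) _   _   = refl
reflect-=ₑ N (fin (suc x)) ∞             x<N _   with N ∸ x | m<n⇒0<n∸m x<N
... | suc _ | _ = refl
reflect-=ₑ N (fin (suc x)) (fin zero)    _   _   = refl
reflect-=ₑ N (fin (suc x)) (fin (suc y)) x<N y<N = ∸-≡ᵇ-reverse (<⇒≤ x<N) (<⇒≤ y<N)

=ₑ-refl : ∀ a → (a =ₑ a) ≡ true
=ₑ-refl ∞       = refl
=ₑ-refl (fin x) = ≡true (≡⇒≡ᵇ x x refl)

=ₑ-sound : ∀ a b → (a =ₑ b) ≡ true → a ≡ b
=ₑ-sound ∞       ∞       _ = refl
=ₑ-sound (fin x) (fin y) e = cong fin (≡ᵇ⇒≡ x y (Equivalence.from T-≡ e))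

=ₑ-sym : ∀ a b → (a =ₑ b) ≡ (b =ₑ a)
=ₑ-sym ∞       ∞       = refl
=ₑ-sym ∞       (fin y) = refl
=ₑ-sym (fin x) ∞       = refl
=ₑ-sym (fin x) (fin y) = det (≡ᵇ-reflects x y) (fromEquivalence (sym ∘ ≡ᵇ⇒≡ y x) (≡⇒≡ᵇ y x ∘ sym))

=ₑ-∧-not-swap : ∀ a b e → ((a =ₑ b) ∧ not (b =ₑ e)) ≡ ((b =ₑ a) ∧ not (a =ₑ e))
=ₑ-∧-not-swap a b e with a =ₑ b in a=b
... | true  rewrite =ₑ-sound a b a=b | =ₑ-refl b = refl
... | false rewrite =ₑ-sym b a | a=b = refl

cyclic-pairs-reverse : ∀ α β γ {x y} → x ≡ y →
  ((α ∧ β) ∨ (β ∧ γ) ∨ (γ ∧ α) ∨ x) ≡ ((α ∧ γ) ∨ (γ ∧ β) ∨ (β ∧ α) ∨ y)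
cyclic-pairs-reverse true  true  true  refl = refl
cyclic-pairs-reverse true  true  false refl = refl
cyclic-pairs-reverse true  false true  refl = refl
cyclic-pairs-reverse true  false false refl = refl
cyclic-pairs-reverse false true  true  refl = refl
cyclic-pairs-reverse false true  false refl = refl
cyclic-pairs-reverse false false true  refl = refl
cyclic-pairs-reverse false false false refl = refl

Q-reflect : ∀ N a b e → InRange N a → InRange N b → InRange N e →
  Q (reflect N a) (reflect N b) (reflect N e) ≡ Q b a e
Q-reflect N a b e ra rb re
  rewrite reflect-<ₑ N a b ra rb | reflect-<ₑ N b e rb re | reflect-<ₑ N e a re ra
        | reflect-=ₑ N a b ra rb | reflect-=ₑ N b e rb re
  = cyclic-pairs-reverse (b <ₑ a) (e <ₑ b) (a <ₑ e) (=ₑ-∧-not-swap a b e)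

module OrderInvariance (ψ : Ext → Ext) (P : Ext → Set)
  (<ₑ-pres : ∀ {a b} → P a → P b → (ψ a <ₑ ψ b) ≡ (a <ₑ b))
  (=ₑ-pres : ∀ {a b} → P a → P b → (ψ a =ₑ ψ b) ≡ (a =ₑ b)) where

  ≤ₑ-pres : ∀ {a b} → P a → P b → (ψ a ≤ₑ ψ b) ≡ (a ≤ₑ b)
  ≤ₑ-pres pa pb = cong₂ _∨_ (<ₑ-pres pa pb) (=ₑ-pres pa pb)

  Invariant : Chain → Set
  Invariant ch = ∀ {z w u v} → P z → P w → P u → P v → ch (ψ z) (ψ w) (ψ u) (ψ v) ≡ ch z w u v

  infixr 6 _∧≡_
  infixr 5 _∨≡_ _∨ᵢ_

  _∧≡_ : ∀ {a b c d} → a ≡ b → c ≡ d → (a ∧ c) ≡ (b ∧ d)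
  _∧≡_ = cong₂ _∧_

  _∨≡_ : ∀ {a b c d} → a ≡ b → c ≡ d → (a ∨ c) ≡ (b ∨ d)
  _∨≡_ = cong₂ _∨_

  _∨ᵢ_ : ∀ {ch ch′} → Invariant ch → Invariant ch′ → Invariant (λ z w u v → ch z w u v ∨ ch′ z w u v)
  (i ∨ᵢ j) pz pw pu pv = i pz pw pu pv ∨≡ j pz pw pu pv

  swapped : ∀ {ch} → Invariant ch → Invariant (λ z w u v → ch w z v u)
  swapped i pz pw pu pv = i pw pz pv pu

  sStar-invariant : Invariant sStar
  sStar-invariant pz pw pu pv =
    (=ₑ-pres pz pw ∧≡ <ₑ-pres pv pw ∧≡ <ₑ-pres pu pv)
    ∨≡ (≤ₑ-pres pz pu ∧≡ =ₑ-pres pz pw ∧≡ <ₑ-pres pv pw)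
    ∨≡ (<ₑ-pres pu pv ∧≡ ≤ₑ-pres pz pu ∧≡ =ₑ-pres pz pw)

  common₁-invariant : Invariant common₁
  common₁-invariant pz pw pu pv = <ₑ-pres pv pz ∧≡ ≤ₑ-pres pw pv ∧≡ <ₑ-pres pu pw

  common₂-invariant : Invariant common₂
  common₂-invariant pz pw pu pv = ≤ₑ-pres pz pu ∧≡ <ₑ-pres pv pz ∧≡ ≤ₑ-pres pw pv

  A1-invariant : Invariant A1
  A1-invariant pz pw pu pv = <ₑ-pres pw pz ∧≡ <ₑ-pres pv pw ∧≡ <ₑ-pres pu pv

  A2-invariant : Invariant A2
  A2-invariant pz pw pu pv = <ₑ-pres pw pz ∧≡ <ₑ-pres pu pw ∧≡ <ₑ-pres pv pu

  B1-invariant : Invariant B1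
  B1-invariant pz pw pu pv = <ₑ-pres pv pu ∧≡ ≤ₑ-pres pz pv ∧≡ <ₑ-pres pw pz

  B2-invariant : Invariant B2
  B2-invariant pz pw pu pv = <ₑ-pres pu pv ∧≡ ≤ₑ-pres pz pu ∧≡ <ₑ-pres pw pz

  C1-invariant : Invariant C1
  C1-invariant pz pw pu pv = <ₑ-pres pu pz ∧≡ <ₑ-pres pv pu ∧≡ ≤ₑ-pres pw pv

  C2-invariant : Invariant C2
  C2-invariant pz pw pu pv = <ₑ-pres pv pz ∧≡ <ₑ-pres pu pv ∧≡ ≤ₑ-pres pw pu

  D1-invariant : Invariant D1
  D1-invariant pz pw pu pv = ≤ₑ-pres pz pv ∧≡ <ₑ-pres pw pz ∧≡ <ₑ-pres pu pw

  D2-invariant : Invariant D2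
  D2-invariant pz pw pu pv = ≤ₑ-pres pz pu ∧≡ <ₑ-pres pw pz ∧≡ <ₑ-pres pv pw

  specific-invariant : ∀ S → Invariant (specific S)
  specific-invariant S₁ = A1-invariant ∨ᵢ B1-invariant ∨ᵢ C1-invariant ∨ᵢ D1-invariant
  specific-invariant S₂ = A1-invariant ∨ᵢ B2-invariant ∨ᵢ C1-invariant ∨ᵢ D1-invariant
  specific-invariant S₃ = A2-invariant ∨ᵢ B1-invariant ∨ᵢ C1-invariant ∨ᵢ D1-invariant
  specific-invariant S₄ = A2-invariant ∨ᵢ B2-invariant ∨ᵢ C1-invariant ∨ᵢ D1-invariant
  specific-invariant S₅ = A1-invariant ∨ᵢ B1-invariant ∨ᵢ C2-invariant ∨ᵢ D2-invariant
  specific-invariant S₆ = A2-invariant ∨ᵢ B1-invariant ∨ᵢ C2-invariant ∨ᵢ D2-invariant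
  specific-invariant S₇ = A1-invariant ∨ᵢ B2-invariant ∨ᵢ C2-invariant ∨ᵢ D2-invariant
  specific-invariant S₈ = A2-invariant ∨ᵢ B2-invariant ∨ᵢ C2-invariant ∨ᵢ D2-invariant

  six-invariant : ∀ S → Invariant (six S)
  six-invariant S = common₁-invariant ∨ᵢ common₂-invariant ∨ᵢ specific-invariant S

  Q-S-invariant : ∀ S → Invariant (Q-S S)
  Q-S-invariant S = sStar-invariant ∨ᵢ six-invariant S ∨ᵢ swapped (six-invariant S)

sum-zero : ∀ {xs} → All (_≡ 0) xs → sum xs ≡ 0
sum-zero []          = refl
sum-zero (refl ∷ zs) = sum-zero zs

sum-map-+ : ∀ {A : Set} (f h : A → ℕ) xs →
  sum (map (λ x → f x + h x) xs) ≡ sum (map f xs) + sum (map h xs)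
sum-map-+ f h []       = refl
sum-map-+ f h (x ∷ xs) = begin
  f x + h x + sum (map (λ x → f x + h x) xs)    ≡⟨ cong (f x + h x +_) (sum-map-+ f h xs) ⟩
  f x + h x + (sum (map f xs) + sum (map h xs)) ≡⟨ interchange (f x) (h x) _ _ ⟩
  f x + sum (map f xs) + (h x + sum (map h xs)) ∎
  where open ≡-Reasoning

sum-map-*ʳ : ∀ {A : Set} (f : A → ℕ) w xs → sum (map (λ x → f x * w) xs) ≡ sum (map f xs) * w
sum-map-*ʳ f w []       = refl
sum-map-*ʳ f w (x ∷ xs) =
  trans (cong (f x * w +_) (sum-map-*ʳ f w xs)) (sym (*-distribʳ-+ w (f x) (sum (map f xs))))

sum-map-swap : ∀ {A B : Set} (f : A → B → ℕ) xs ys →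
  sum (map (λ x → sum (map (f x) ys)) xs) ≡ sum (map (λ y → sum (map (λ x → f x y) xs)) ys)
sum-map-swap f []       ys = sym (sum-zero (All-map⁺ (universal (λ _ → refl) ys)))
sum-map-swap f (x ∷ xs) ys =
  trans (cong (sum (map (f x) ys) +_) (sum-map-swap f xs ys))
        (sym (sum-map-+ (f x) (λ y → sum (map (λ x′ → f x′ y) xs)) ys))

sum-rows-cong : ∀ k {f h : ℕ → ℕ} → (∀ {j} → j < k → f (suc j) ≡ h (suc j)) →
  sum (map f (rows k)) ≡ sum (map h (rows k))
sum-rows-cong k f≗h = cong sum (map-cong-local (All-map⁺ (applyUpTo⁺₁ id k f≗h)))

applyUpTo-∸ : ∀ k → applyUpTo (k ∸_) k ≡ applyDownFrom suc k
applyUpTo-∸ zero    = refl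
applyUpTo-∸ (suc k) = cong (suc k ∷_) (applyUpTo-∸ k)

rows-complement : ∀ k → map (suc k ∸_) (rows k) ≡ reverse (rows k)
rows-complement k = begin
  map (suc k ∸_) (map suc (upTo k)) ≡⟨ map-∘ (upTo k) ⟨
  map (k ∸_) (upTo k)               ≡⟨ map-applyUpTo id (k ∸_) k ⟩
  applyUpTo (k ∸_) k                ≡⟨ applyUpTo-∸ k ⟩
  applyDownFrom suc k               ≡⟨ reverse-applyUpTo suc k ⟨
  reverse (applyUpTo suc k)         ≡⟨ cong reverse (map-applyUpTo id suc k) ⟨
  reverse (map suc (upTo k))        ∎
  where open ≡-Reasoning

sum-rows-reverse : ∀ k (f : ℕ → ℕ) → sum (map (λ r → f (suc k ∸ r)) (rows k)) ≡ sum (map f (rows k))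
sum-rows-reverse k f = begin
  sum (map (f ∘ (suc k ∸_)) (rows k))   ≡⟨ cong sum (map-∘ (rows k)) ⟩
  sum (map f (map (suc k ∸_) (rows k))) ≡⟨ cong (sum ∘ map f) (rows-complement k) ⟩
  sum (map f (reverse (rows k)))        ≡⟨ sum-↭ (↭-map⁺ f (↭-reverse (rows k))) ⟩
  sum (map f (rows k))                  ∎
  where open ≡-Reasoning

sumPairs-cong : ∀ n {f h : Fin n → Fin n → ℕ} → (∀ c d → f c d ≡ h c d) → sumPairs n f ≡ sumPairs n h
sumPairs-cong n f≗h = cong sum (concatMap-cong (λ c → map-cong (λ d →
  cong (λ t → if toℕ c <ᵇ toℕ d then t else 0) (f≗h c d)) (allFin n)) (allFin n))

sumPairs-zero : ∀ n {f : Fin n → Fin n → ℕ} → (∀ c d → f c d ≡ 0) → sumPairs n f ≡ 0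
sumPairs-zero n f≡0 = sum-zero (concat⁺ (All-map⁺ (universal (λ c →
  All-map⁺ (universal (λ d → if-zero (toℕ c <ᵇ toℕ d) (f≡0 c d)) (allFin n))) (allFin n))))
  where
  if-zero : ∀ b {x} → x ≡ 0 → (if b then x else 0) ≡ 0
  if-zero true  x≡0 = x≡0
  if-zero false _   = refl

Bounded : ∀ {k n} → ℕ → Filling k n → Set
Bounded N ρ = ∀ i c → ρ i c ≤ N

maxEntry-bounded : ∀ {k n} (ρ : Filling k n) → Bounded (maxEntry ρ) ρ
maxEntry-bounded {k} {n} ρ i c = foldr-⊔-upper _ (∈-concatMap⁺ (λ i → map (ρ i) (allFin n))
  (Any.map (λ { refl → ∈-map⁺ (ρ i) (∈-allFin c) }) (∈-allFin i)))
  where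
  foldr-⊔-upper : ∀ {x} xs → x ∈ xs → x ≤ foldr _⊔_ 0 xs
  foldr-⊔-upper (y ∷ ys) (here refl) = m≤m⊔n y _
  foldr-⊔-upper (y ∷ ys) (there x∈ys) = ≤-trans (foldr-⊔-upper ys x∈ys) (m≤n⊔m y _)

RowEquivalent-bounded : ∀ {k n N} {σ τ : Filling k n} → RowEquivalent τ σ → Bounded N σ → Bounded N τ
RowEquivalent-bounded {σ = σ} {τ} τ∼σ σ≤N i c
  with c′ , _ , τic≡σic′ ← ∈-map⁻ (σ i) (∈-resp-↭ (τ∼σ i) (∈-map⁺ (τ i) (∈-allFin c)))
  = subst (_≤ _) (sym τic≡σic′) (σ≤N i c′)

ext-fin : ∀ {k n} (ρ : Filling k n) i c → ext ρ (suc (toℕ i)) c ≡ fin (ρ i c)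
ext-fin {k} ρ i c with toℕ i <? k
... | yes i<k = cong (λ j → fin (ρ j c)) (fromℕ<-toℕ i i<k)
... | no  i≮k = ⊥-elim (i≮k (toℕ<n i))

ext-above : ∀ {k n} (ρ : Filling k n) c → ext ρ (suc k) c ≡ fin 0
ext-above {k} ρ c with k <? k
... | yes k<k = ⊥-elim (<-irrefl refl k<k)
... | no  _   = refl

ext-inRange : ∀ {k n N} {ρ : Filling k n} → Bounded N ρ → ∀ r c → InRange N (ext ρ r c)
ext-inRange         ρ≤N zero    c = tt
ext-inRange {k} ρ≤N (suc r) c with r <? k
... | yes _ = ρ≤N _ c
... | no  _ = z≤n

ext-complFlip : ∀ {k n} N {ρ : Filling k n} → Positive ρ → ∀ r c →
  ext (complFlip N ρ) r c ≡ reflect N (ext ρ (suc k ∸ r) c)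
ext-complFlip N {ρ} ρ>0 zero c = sym (cong (reflect N) (ext-above ρ c))
ext-complFlip {k} N {ρ} ρ>0 (suc r) c with r <? k
... | no  r≮k = sym (cong (λ t → reflect N (ext ρ t c)) (m≤n⇒m∸n≡0 (≮⇒≥ r≮k)))
... | yes r<k = sym (begin
  reflect N (ext ρ (k ∸ r) c)       ≡⟨ cong (λ t → reflect N (ext ρ t c)) k∸r≡1+i′ ⟩
  reflect N (ext ρ (suc (toℕ i′)) c) ≡⟨ cong (reflect N) (ext-fin ρ i′ c) ⟩
  reflect N (fin (ρ i′ c))          ≡⟨ reflect-fin N (ρ>0 i′ c) ⟩
  fin (suc N ∸ ρ i′ c)              ∎)
  where
  open ≡-Reasoning
  i′ : Fin k
  i′ = opposite (fromℕ< r<k)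
  k∸r≡1+i′ : k ∸ r ≡ suc (toℕ i′)
  k∸r≡1+i′ = trans (+-∸-assoc 1 r<k)
    (cong suc (sym (trans (opposite-prop _) (cong (λ t → k ∸ suc t) (toℕ-fromℕ< r<k)))))

RowEquivalent-complFlip : ∀ {k n} N {σ τ : Filling k n} →
  RowEquivalent τ σ → RowEquivalent (complFlip N τ) (complFlip N σ)
RowEquivalent-complFlip {n = n} N τ∼σ i =
  subst₂ _↭_ (sym (map-∘ (allFin n))) (sym (map-∘ (allFin n))) (↭-map⁺ (suc N ∸_) (τ∼σ (opposite i)))

SameTopRow⇒SameBottomRow-complFlip : ∀ {k n} N {σ τ : Filling k n} →
  SameTopRow τ σ → SameBottomRow (complFlip N τ) (complFlip N σ)
SameTopRow⇒SameBottomRow-complFlip {k} N top i c i≡0 =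
  cong (suc N ∸_) (top (opposite i) c (trans (opposite-prop i) (cong (λ t → k ∸ suc t) i≡0)))

majWeight : ℕ → ℕ → ℕ
majWeight k r = bit (2 ≤ᵇ r) * (k ∸ r + 1)

bit-∧-* : ∀ b a w → bit (b ∧ a) * w ≡ bit a * (bit b * w)
bit-∧-* true  a w = cong (bit a *_) (sym (*-identityˡ w))
bit-∧-* false a w = sym (*-zeroʳ (bit a))

n<ᵇn≡false : ∀ n → (n <ᵇ n) ≡ false
n<ᵇn≡false zero    = refl
n<ᵇn≡false (suc n) = n<ᵇn≡false n

invTallLeft-zero : ∀ {k n} (ρ : Filling k n) → invTallLeft ρ ≡ 0
invTallLeft-zero {k} {n} ρ = sum-zero (All-map⁺ (universal (λ r →
  sumPairs-zero n (λ c d → bit-false-∧ (k <ᵇ k) (n<ᵇn≡false k))) (rows k)))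
  where
  bit-false-∧ : ∀ b {x} → b ≡ false → bit (b ∧ x) ≡ 0
  bit-false-∧ _ refl = refl

module ComplFlip {k n} (N : ℕ) {ρ : Filling k n} (ρ>0 : Positive ρ) (ρ≤N : Bounded N ρ) where

  ρ′ : Filling k n
  ρ′ = complFlip N ρ

  ext-below : ∀ {j} c → j < k → ext ρ′ j c ≡ reflect N (ext ρ (suc (k ∸ j)) c)
  ext-below {j} c j<k =
    trans (ext-complFlip N ρ>0 j c) (cong (λ t → reflect N (ext ρ t c)) (+-∸-assoc 1 (<⇒≤ j<k)))

  ascent-flip : ∀ {j} c → j < k →
    (ext ρ′ j c <ₑ ext ρ′ (suc j) c) ≡ (ext ρ (k ∸ j) c <ₑ ext ρ (suc (k ∸ j)) c)
  ascent-flip {j} c j<k rewrite ext-below c j<k | ext-complFlip N ρ>0 (suc j) c =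
    reflect-<ₑ N _ _ (ext-inRange ρ≤N (suc (k ∸ j)) c) (ext-inRange ρ≤N (k ∸ j) c)

  maj-complFlip : maj ρ′ ≡ sum (map (λ r → ascents ρ (suc k ∸ r) * majWeight k r) (rows k))
  maj-complFlip = begin
    maj ρ′
      ≡⟨ cong sum (map-cong (λ c → sum-rows-cong k (majTerm c)) (allFin n)) ⟩
    sumCols n (λ c → sum (map (λ r → ascentBit (suc k ∸ r) c * majWeight k r) (rows k)))
      ≡⟨ sum-map-swap (λ c r → ascentBit (suc k ∸ r) c * majWeight k r) (allFin n) (rows k) ⟩
    sum (map (λ r → sumCols n (λ c → ascentBit (suc k ∸ r) c * majWeight k r)) (rows k))
      ≡⟨ cong sum (map-cong (λ r → sum-map-*ʳ (ascentBit (suc k ∸ r)) (majWeight k r) (allFin n)) (rows k)) ⟩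
    sum (map (λ r → ascents ρ (suc k ∸ r) * majWeight k r) (rows k)) ∎
    where
    open ≡-Reasoning
    ascentBit : ℕ → Fin n → ℕ
    ascentBit s c = bit (ext ρ s c <ₑ ext ρ (suc s) c)
    majTerm : ∀ c {j} → j < k →
      bit ((2 ≤ᵇ suc j) ∧ (ext ρ′ j c <ₑ ext ρ′ (suc j) c)) * (k ∸ suc j + 1)
        ≡ ascentBit (k ∸ j) c * majWeight k (suc j)
    majTerm c {j} j<k = trans (cong (λ b → bit ((2 ≤ᵇ suc j) ∧ b) * (k ∸ suc j + 1)) (ascent-flip c j<k))
                              (bit-∧-* (2 ≤ᵇ suc j) _ (k ∸ suc j + 1))

  inv-complFlip : inv ρ′ ≡ quinv ρ
  inv-complFlip = trans (sum-rows-cong k λ j<k → sumPairs-cong n (λ c d → cong bit (Q-flip j<k c d)))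
                        (sum-rows-reverse k quinvRow)
    where
    quinvRow : ℕ → ℕ
    quinvRow s = sumPairs n λ c d → bit (Q (ext ρ (suc s) c) (ext ρ s c) (ext ρ s d))
    Q-flip : ∀ {j} → j < k → ∀ c d → Q (ext ρ′ (suc j) c) (ext ρ′ j c) (ext ρ′ (suc j) d)
                                      ≡ Q (ext ρ (suc (k ∸ j)) c) (ext ρ (k ∸ j) c) (ext ρ (k ∸ j) d)
    Q-flip {j} j<k c d rewrite ext-below c j<k | ext-complFlip N ρ>0 (suc j) c | ext-complFlip N ρ>0 (suc j) d =
      Q-reflect N _ _ _ (ext-inRange ρ≤N (k ∸ j) c) (ext-inRange ρ≤N _ c) (ext-inRange ρ≤N (k ∸ j) d)

maj-complFlip-cong : ∀ {k n} {M N} {σ τ : Filling k n} →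
  Positive τ → Bounded M τ → Positive σ → Bounded N σ →
  (∀ r → 1 ≤ r → suc r ≤ k → ascents τ r ≡ ascents σ r) →
  maj (complFlip M τ) ≡ maj (complFlip N σ)
maj-complFlip-cong {k} {M = M} {N} {σ} {τ} τ>0 τ≤M σ>0 σ≤N same-ascents = begin
  maj (complFlip M τ)                                            ≡⟨ ComplFlip.maj-complFlip M τ>0 τ≤M ⟩
  sum (map (λ r → ascents τ (suc k ∸ r) * majWeight k r) (rows k)) ≡⟨ sum-rows-cong k weighted-ascents ⟩
  sum (map (λ r → ascents σ (suc k ∸ r) * majWeight k r) (rows k)) ≡⟨ ComplFlip.maj-complFlip N σ>0 σ≤N ⟨
  maj (complFlip N σ)                                            ∎
  where
  open ≡-Reasoning
  weighted-ascents : ∀ {j} → j < k →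
    ascents τ (k ∸ j) * majWeight k (suc j) ≡ ascents σ (k ∸ j) * majWeight k (suc j)
  weighted-ascents {zero}  _   = trans (*-zeroʳ (ascents τ k)) (sym (*-zeroʳ (ascents σ k)))
  weighted-ascents {suc j} j<k = cong (_* majWeight k (suc (suc j)))
    (same-ascents (k ∸ suc j) (m<n⇒0<n∸m j<k) (∸-monoʳ-< {k} {suc j} {0} (s≤s z≤n) (<⇒≤ j<k)))

η-natural-complFlip : ∀ {k n} S N {τ : Filling k n} → Positive τ → Bounded N τ →
  η S (natural (complFlip N τ)) ≡ η S τ
η-natural-complFlip {k} {n} S N {τ} τ>0 τ≤N =
  sum-rows-cong k λ {j} j<k → sumPairs-cong n λ c d → cong bit (Q-S-twice-reflected j<k c d)
  where
  τ′ : Filling k n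
  τ′ = complFlip N τ

  M : ℕ
  M = maxEntry τ′

  τ′>0 : Positive τ′
  τ′>0 i c = m<n⇒0<n∸m (s≤s (τ≤N _ c))

  InRanges : Ext → Set
  InRanges a = InRange N a × InRange M (reflect N a)

  open OrderInvariance (reflect M ∘ reflect N) InRanges
    (λ {a} {b} (aN , aM) (bN , bM) → trans (reflect-<ₑ M _ _ aM bM) (reflect-<ₑ N b a bN aN))
    (λ {a} {b} (aN , aM) (bN , bM) → trans (reflect-=ₑ M _ _ aM bM) (reflect-=ₑ N a b aN bN))

  ext-τ′ : ∀ {r} c → r ≤ suc k → ext τ′ (suc k ∸ r) c ≡ reflect N (ext τ r c)
  ext-τ′ {r} c r≤1+k = trans (ext-complFlip N τ>0 (suc k ∸ r) c) (cong (λ t → reflect N (ext τ t c)) (m∸[m∸n]≡n r≤1+k))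

  ext-natural : ∀ {r} c → r ≤ suc k → ext (natural τ′) r c ≡ reflect M (reflect N (ext τ r c))
  ext-natural {r} c r≤1+k = trans (ext-complFlip M τ′>0 r c) (cong (reflect M) (ext-τ′ c r≤1+k))

  ext-inRanges : ∀ {r} c → r ≤ suc k → InRanges (ext τ r c)
  ext-inRanges {r} c r≤1+k = ext-inRange τ≤N r c
    , subst (InRange M) (ext-τ′ c r≤1+k) (ext-inRange (maxEntry-bounded τ′) (suc k ∸ r) c)

  Q-S-twice-reflected : ∀ {j} → j < k → ∀ c d →
    Q-S S (ext (natural τ′) (suc (suc j)) c) (ext (natural τ′) (suc (suc j)) d)
          (ext (natural τ′) (suc j) c) (ext (natural τ′) (suc j) d)
      ≡ Q-S S (ext τ (suc (suc j)) c) (ext τ (suc (suc j)) d) (ext τ (suc j) c) (ext τ (suc j) d)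
  Q-S-twice-reflected {j} j<k c d
    rewrite ext-natural c (s≤s j<k) | ext-natural d (s≤s j<k)
          | ext-natural c (s≤s (<⇒≤ j<k)) | ext-natural d (s≤s (<⇒≤ j<k))
    = Q-S-invariant S (ext-inRanges c (s≤s j<k)) (ext-inRanges d (s≤s j<k))
                      (ext-inRanges c (s≤s (<⇒≤ j<k))) (ext-inRanges d (s≤s (<⇒≤ j<k)))

η*-complFlip : ∀ {k n} S N {τ : Filling k n} → Positive τ → Bounded N τ → η* S (complFlip N τ) ≡ η S τ
η*-complFlip S N {τ} τ>0 τ≤N =
  trans (cong₂ _+_ (η-natural-complFlip S N τ>0 τ≤N) (invTallLeft-zero (complFlip N τ))) (+-identityʳ _)

corollary5p2 : (k n : ℕ) (S : PatternSet) (γ : Filling k n → Filling k n)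
    → IsBijectionOnT γ
    → (∀ σ → Positive σ → RowEquivalent (γ σ) σ)
    → (∀ σ → Positive σ → maj (γ σ) ≡ maj σ)
    → (∀ σ → Positive σ → η S (γ σ) ≡ quinv σ)
    → (∀ σ → Positive σ → SameTopRow (γ σ) σ)
    → (∀ σ → Positive σ → ∀ r → 1 ≤ r → suc r ≤ k → ascents (γ σ) r ≡ ascents σ r)
    → ∀ σ → Positive σ
    → RowEquivalent (complFlip (maxEntry σ) (γ σ)) (complFlip (maxEntry σ) σ)
      × SameBottomRow (complFlip (maxEntry σ) (γ σ)) (complFlip (maxEntry σ) σ)
      × maj (complFlip (maxEntry σ) (γ σ)) ≡ maj (complFlip (maxEntry σ) σ)
      × η* S (complFlip (maxEntry σ) (γ σ)) ≡ inv (complFlip (maxEntry σ) σ)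
-- Only that γ maps 𝒯(λ) into itself is needed.
corollary5p2 k n S γ (γ>0 , _) row-equivalent _ η≡quinv same-top same-ascents σ σ>0 =
  RowEquivalent-complFlip N (row-equivalent σ σ>0)
  , SameTopRow⇒SameBottomRow-complFlip N (same-top σ σ>0)
  , maj-complFlip-cong γσ>0 γσ≤N σ>0 σ≤N (same-ascents σ σ>0)
  , (begin
      η* S (complFlip N (γ σ)) ≡⟨ η*-complFlip S N γσ>0 γσ≤N ⟩
      η S (γ σ)                ≡⟨ η≡quinv σ σ>0 ⟩
      quinv σ                  ≡⟨ ComplFlip.inv-complFlip N σ>0 σ≤N ⟨
      inv (complFlip N σ)      ∎)
  where
  open ≡-Reasoning
  N : ℕ
  N = maxEntry σ
  σ≤N : Bounded N σ
  σ≤N = maxEntry-bounded σ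
  γσ>0 : Positive (γ σ)
  γσ>0 = γ>0 σ σ>0
  γσ≤N : Bounded N (γ σ)
  γσ≤N = RowEquivalent-bounded (row-equivalent σ σ>0) σ≤N
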